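{- Let $w\in\mathbb Z^{V_d}$ be a valid outcome whose positive support has size at most $3$. Then $w$ is a nonnegative integer... more precisely, $w$ is a nonnegative multiple of one of the following outcomes (each given by its nonzero entries): (1) $w_{0,0}=-1$, $w_{1,0}=1$, $w_{0,1}=1$; (2) $w_{0,0}=-1$, $w_{3,0}=1$, $w_{1,1}=3$, $w_{0,3}=1$; (3) $w_{0,0}=-1$, $w_{2,0}=1$, $w_{1,1}=2$, $w_{0,2}=1$; (4) $w_{0,0}=-1$, $w_{2,0}=1$, $w_{0,1}=1$, $w_{1,1}=1$; (5) $w_{0,0}=-1$, $w_{1,0}=1$, $w_{1,1}=1$, $w_{0,2}=1$.
   Context: $d$ is a nonnegative integer, $V_d=\{(i,j)\in\mathbb Z_{\geq0}^2\mid i+j\leq d\}$. A chip configuration is $w=(w_{i,j})\in\mathbb Z^{V_d}$. A splitting move at $p\in V_{d-1}$ decreases $w_p$ by $1$ and increases $w_{p+(1,0)}$ and $w_{p+(0,1)}$ by $1$; an unsplitting move is its inverse. An outcome is a configuration reachable from the zero configuration by finitely many such moves. The positive support is $\{(i,j)\mid w_{i,j}>0\}$; $w$ is valid if $w_{i,j}\geq0$ for all $(i,j)\neq(0,0)$. -}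

module Defs where

open import Data.Nat using (ℕ; _+_; _<_; _≤_; _≡ᵇ_)
open import Data.Integer using (ℤ; +_; -_; 0ℤ; 1ℤ; -1ℤ) renaming (_+_ to _+ℤ_; _-_ to _-ℤ_; _<_ to _<ℤ_; _≤_ to _≤ℤ_)
open import Data.Bool using (if_then_else_; _∧_)
open import Data.Product using (_×_; _,_; Σ; ∃)
open import Data.List using (List; []; _∷_; length)
open import Data.List.Membership.Propositional using (_∈_)
open import Relation.Binary.PropositionalEquality using (_≡_)
open import Relation.Nullary using (¬_)

-- Only the entries at points of V_d (i + j ≤ d) are meaningful; all notions
-- below only look at (or only change) entries inside V_d.
Config : Set
Config = ℕ → ℕ → ℤ

zeroConfig : Config
zeroConfig _ _ = 0ℤ

δ : ℕ → ℕ → ℕ → ℕ → ℤ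
δ a b i j = if (i ≡ᵇ a) ∧ (j ≡ᵇ b) then 1ℤ else 0ℤ

split : ℕ → ℕ → Config → Config
split a b w i j = ((w i j -ℤ δ a b i j) +ℤ δ (Data.Nat.suc a) b i j) +ℤ δ a (Data.Nat.suc b) i j

unsplit : ℕ → ℕ → Config → Config
unsplit a b w i j = ((w i j +ℤ δ a b i j) -ℤ δ (Data.Nat.suc a) b i j) -ℤ δ a (Data.Nat.suc b) i j

data Reachable (d : ℕ) : Config → Set where
  base  : Reachable d zeroConfig
  spl   : ∀ {w} a b → a + b < d → Reachable d w → Reachable d (split a b w)
  unspl : ∀ {w} a b → a + b < d → Reachable d w → Reachable d (unsplit a b w)

_≈[_]_ : Config → ℕ → Config → Set
w ≈[ d ] v = ∀ i j → i + j ≤ d → w i j ≡ v i j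

Outcome : ℕ → Config → Set
Outcome d w = Σ Config λ v → Reachable d v × (w ≈[ d ] v)

Valid : ℕ → Config → Set
Valid d w = ∀ i j → i + j ≤ d → ¬ ((i , j) ≡ (0 , 0)) → 0ℤ ≤ℤ w i j

PosSupportAtMost3 : ℕ → Config → Set
PosSupportAtMost3 d w =
  Σ (List (ℕ × ℕ)) λ L → length L ≤ 3 ×
    (∀ i j → i + j ≤ d → 0ℤ <ℤ w i j → (i , j) ∈ L)

entries : List (ℕ × ℕ × ℤ) → Config
entries [] i j = 0ℤ
entries ((a , b , v) ∷ rest) i j = if (i ≡ᵇ a) ∧ (j ≡ᵇ b) then v else entries rest i j

out1 out2 out3 out4 out5 : Config
out1 = entries ((0 , 0 , -1ℤ) ∷ (1 , 0 , 1ℤ) ∷ (0 , 1 , 1ℤ) ∷ [])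
out2 = entries ((0 , 0 , -1ℤ) ∷ (3 , 0 , 1ℤ) ∷ (1 , 1 , + 3) ∷ (0 , 3 , 1ℤ) ∷ [])
out3 = entries ((0 , 0 , -1ℤ) ∷ (2 , 0 , 1ℤ) ∷ (1 , 1 , + 2) ∷ (0 , 2 , 1ℤ) ∷ [])
out4 = entries ((0 , 0 , -1ℤ) ∷ (2 , 0 , 1ℤ) ∷ (0 , 1 , 1ℤ) ∷ (1 , 1 , 1ℤ) ∷ [])
out5 = entries ((0 , 0 , -1ℤ) ∷ (1 , 0 , 1ℤ) ∷ (1 , 1 , 1ℤ) ∷ (0 , 2 , 1ℤ) ∷ [])

Basic : List Config
Basic = out1 ∷ out2 ∷ out3 ∷ out4 ∷ out5 ∷ []

scale : ℕ → Config → Config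
scale k u i j = (+ k) Data.Integer.* u i j

-- Pairing a configuration with a weight f on V_d satisfying
-- f(p) = f(p + (1,0)) + f(p + (0,1)) is unchanged by splitting, so it vanishes
-- on every outcome.  Since t^i (1 − t)^j = t^(i+1) (1 − t)^j + t^i (1 − t)^(j+1),
-- every linear functional of these polynomials is such a weight; we use the value
-- at t = 1/2 and low-order Taylor coefficients at t = 0 and at t = 1.
--
-- A valid configuration is its origin entry plus at most three positive masses.
-- The t = 1/2 weight is positive, so a nonnegative origin forces the zero
-- configuration.  For an origin entry −N the order-0 weights put total mass N
-- on the column i = 0 and on the row j = 0.  Without interior masses the
-- order-1 weight at t = 0 pins all of it to (0,1) and (1,0): this is N·(1).
-- Otherwise there is one mass on the column, one on the row and one inside;
-- the order-1 weights locate them, and the t = 1/2 and order-2 weights exclude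
-- every placement except those of (2)–(5).

module Submission where

open import Defs
open import Data.Nat using (ℕ; zero; suc; _+_; _*_; _∸_; _^_; _≤_; _<_; z≤n; s≤s; _≤?_; _≡ᵇ_)
import Data.Nat.Properties as ℕ
import Data.Nat.Tactic.RingSolver as ℕ-Solver
open import Data.Integer using (ℤ; +_; -[1+_]; -_; 0ℤ; 1ℤ; -1ℤ)
  renaming (_+_ to _+ℤ_; _-_ to _-ℤ_; _*_ to _*ℤ_; _≤_ to _≤ℤ_; _<_ to _<ℤ_)
import Data.Integer.Properties as ℤ
open import Data.Integer.Tactic.RingSolver using (solve-∀)
open import Data.Bool using (true; false; T; _∧_)
open import Data.Bool.Properties using (T-≡; T-∧)
open import Data.Unit using (⊤; tt)
open import Data.Empty using (⊥; ⊥-elim)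
open import Data.Product using (Σ; _×_; _,_; proj₁; proj₂; uncurry)
open import Data.Product.Properties using (≡-dec)
open import Data.Sum using (_⊎_; inj₁; inj₂)
open import Data.List using (List; []; _∷_; length)
open import Data.List.Relation.Unary.All as All using (All; []; _∷_)
open import Data.List.Relation.Unary.Any using (here; there)
open import Data.List.Membership.Propositional using (_∈_)
open import Function using (Equivalence; _∘_; case_of_)
open import Relation.Binary.PropositionalEquality
open import Relation.Nullary using (¬_; Dec; yes; no)

≡ᵇ-refl : ∀ n → (n ≡ᵇ n) ≡ true
≡ᵇ-refl n = Equivalence.to T-≡ (ℕ.≡⇒≡ᵇ n n refl)

δ-diag : ∀ a b → δ a b a b ≡ 1ℤ
δ-diag a b rewrite ≡ᵇ-refl a | ≡ᵇ-refl b = refl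

≡ᵇ∧≡ᵇ⇒≡ : ∀ {i j a b} → (i ≡ᵇ a) ∧ (j ≡ᵇ b) ≡ true → (i , j) ≡ (a , b)
≡ᵇ∧≡ᵇ⇒≡ {i} {j} {a} {b} match =
  let i≡ᵇa , j≡ᵇb = Equivalence.to T-∧ (subst T (sym match) tt)
  in cong₂ _,_ (ℕ.≡ᵇ⇒≡ i a i≡ᵇa) (ℕ.≡ᵇ⇒≡ j b j≡ᵇb)

δ-off : ∀ {a b i j} → (i , j) ≢ (a , b) → δ a b i j ≡ 0ℤ
δ-off {a} {b} {i} {j} ij≢ab with (i ≡ᵇ a) ∧ (j ≡ᵇ b) in match
... | true  = ⊥-elim (ij≢ab (≡ᵇ∧≡ᵇ⇒≡ match))
... | false = refl

pos-+₃ : ∀ x y z → + (x + y + z) ≡ + x +ℤ + y +ℤ + z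
pos-+₃ x y z = trans (ℤ.pos-+ (x + y) z) (cong (_+ℤ + z) (ℤ.pos-+ x y))

pos-*-+ : ∀ x y z → + (x * y + z) ≡ + x *ℤ + y +ℤ + z
pos-*-+ x y z = trans (ℤ.pos-+ (x * y) z) (cong (_+ℤ + z) (ℤ.pos-* x y))

sumUpTo : ℕ → (ℕ → ℤ) → ℤ
sumUpTo zero    f = f 0
sumUpTo (suc n) f = sumUpTo n f +ℤ f (suc n)

sumUpTo-cong : ∀ n {f g} → (∀ k → k ≤ n → f k ≡ g k) → sumUpTo n f ≡ sumUpTo n g
sumUpTo-cong zero    f≗g = f≗g 0 z≤n
sumUpTo-cong (suc n) f≗g =
  cong₂ _+ℤ_ (sumUpTo-cong n λ k k≤n → f≗g k (ℕ.m≤n⇒m≤1+n k≤n)) (f≗g (suc n) ℕ.≤-refl)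

sumUpTo-zero : ∀ n {f} → (∀ k → k ≤ n → f k ≡ 0ℤ) → sumUpTo n f ≡ 0ℤ
sumUpTo-zero n {f} f≗0 = trans (sumUpTo-cong n f≗0) (zeros n)
  where
  zeros : ∀ m → sumUpTo m (λ _ → 0ℤ) ≡ 0ℤ
  zeros zero    = refl
  zeros (suc m) = cong (_+ℤ 0ℤ) (zeros m)

sumUpTo-+ : ∀ n f g → sumUpTo n (λ k → f k +ℤ g k) ≡ sumUpTo n f +ℤ sumUpTo n g
sumUpTo-+ zero    f g = refl
sumUpTo-+ (suc n) f g = trans (cong (_+ℤ (f (suc n) +ℤ g (suc n))) (sumUpTo-+ n f g))
  (interchange (sumUpTo n f) (sumUpTo n g) (f (suc n)) (g (suc n)))
  where
  interchange : ∀ a b c e → (a +ℤ b) +ℤ (c +ℤ e) ≡ (a +ℤ c) +ℤ (b +ℤ e)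
  interchange = solve-∀

sumUpTo-* : ∀ n c f → sumUpTo n (λ k → c *ℤ f k) ≡ c *ℤ sumUpTo n f
sumUpTo-* zero    c f = refl
sumUpTo-* (suc n) c f = trans (cong (_+ℤ c *ℤ f (suc n)) (sumUpTo-* n c f))
  (sym (ℤ.*-distribˡ-+ c (sumUpTo n f) (f (suc n))))

sumUpTo-point : ∀ n x {f} → x ≤ n → (∀ k → k ≢ x → f k ≡ 0ℤ) → sumUpTo n f ≡ f x
sumUpTo-point zero    zero    _   _ = refl
sumUpTo-point (suc n) x {f} x≤1+n f≗0 with x ℕ.≟ suc n
... | yes refl = trans (cong (_+ℤ f x) (sumUpTo-zero n λ k k≤n → f≗0 k λ { refl → ℕ.<-irrefl refl (s≤s k≤n) }))
                       (ℤ.+-identityˡ (f x))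
... | no x≢1+n = trans (cong₂ _+ℤ_ (sumUpTo-point n x (ℕ.≤-pred (ℕ.≤∧≢⇒< x≤1+n x≢1+n)) f≗0)
                                   (f≗0 (suc n) (x≢1+n ∘ sym)))
                       (ℤ.+-identityʳ (f x))

pairing : ℕ → (ℕ → ℕ → ℤ) → Config → ℤ
pairing d f w = sumUpTo d λ i → sumUpTo (d ∸ i) λ j → f i j *ℤ w i j

module Pairing (d : ℕ) (f : ℕ → ℕ → ℤ) where

  pairing-cong : ∀ {u v} → u ≈[ d ] v → pairing d f u ≡ pairing d f v
  pairing-cong u≈v = sumUpTo-cong d λ i i≤d → sumUpTo-cong (d ∸ i) λ j j≤d∸i →
    cong (f i j *ℤ_) (u≈v i j (subst (i + j ≤_) (ℕ.m+[n∸m]≡n i≤d) (ℕ.+-monoʳ-≤ i j≤d∸i)))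

  pairing-ext : ∀ {u v} → (∀ i j → u i j ≡ v i j) → pairing d f u ≡ pairing d f v
  pairing-ext u≗v = pairing-cong λ i j _ → u≗v i j

  pairing-zero : pairing d f zeroConfig ≡ 0ℤ
  pairing-zero = sumUpTo-zero d λ i _ → sumUpTo-zero (d ∸ i) λ j _ → ℤ.*-zeroʳ (f i j)

  pairing-+ : ∀ u v → pairing d f (λ i j → u i j +ℤ v i j) ≡ pairing d f u +ℤ pairing d f v
  pairing-+ u v = trans
    (sumUpTo-cong d λ i _ →
      trans (sumUpTo-cong (d ∸ i) λ j _ → ℤ.*-distribˡ-+ (f i j) (u i j) (v i j)) (sumUpTo-+ (d ∸ i) _ _))
    (sumUpTo-+ d _ _)

  pairing-* : ∀ c u → pairing d f (λ i j → c *ℤ u i j) ≡ c *ℤ pairing d f u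
  pairing-* c u = trans
    (sumUpTo-cong d λ i _ →
      trans (sumUpTo-cong (d ∸ i) λ j _ → swap (f i j) c (u i j)) (sumUpTo-* (d ∸ i) c _))
    (sumUpTo-* d c _)
    where
    swap : ∀ x y z → x *ℤ (y *ℤ z) ≡ y *ℤ (x *ℤ z)
    swap = solve-∀

  pairing-neg : ∀ u → pairing d f (λ i j → - u i j) ≡ - pairing d f u
  pairing-neg u = begin
    pairing d f (λ i j → - u i j)       ≡⟨ pairing-ext (λ i j → sym (ℤ.-1*i≡-i (u i j))) ⟩
    pairing d f (λ i j → -1ℤ *ℤ u i j)  ≡⟨ pairing-* -1ℤ u ⟩
    -1ℤ *ℤ pairing d f u                ≡⟨ ℤ.-1*i≡-i (pairing d f u) ⟩
    - pairing d f u                     ∎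
    where open ≡-Reasoning

  pairing-δ : ∀ {a b} → a + b ≤ d → pairing d f (δ a b) ≡ f a b
  pairing-δ {a} {b} a+b≤d = begin
    pairing d f (δ a b)             ≡⟨ sumUpTo-point d a (ℕ.m+n≤o⇒m≤o a a+b≤d) (λ i i≢a →
                                         sumUpTo-zero (d ∸ i) λ j _ → vanish (i≢a ∘ cong proj₁)) ⟩
    sumUpTo (d ∸ a) (λ j → f a j *ℤ δ a b a j)
                                    ≡⟨ sumUpTo-point (d ∸ a) b b≤d∸a (λ j j≢b → vanish (j≢b ∘ cong proj₂)) ⟩
    f a b *ℤ δ a b a b              ≡⟨ cong (f a b *ℤ_) (δ-diag a b) ⟩
    f a b *ℤ 1ℤ                     ≡⟨ ℤ.*-identityʳ (f a b) ⟩
    f a b                           ∎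
    where
    open ≡-Reasoning
    b≤d∸a : b ≤ d ∸ a
    b≤d∸a = ℕ.m+n≤o⇒m≤o∸n b (subst (_≤ d) (ℕ.+-comm a b) a+b≤d)
    vanish : ∀ {i j} → (i , j) ≢ (a , b) → f i j *ℤ δ a b i j ≡ 0ℤ
    vanish {i} {j} ij≢ab = trans (cong (f i j *ℤ_) (δ-off ij≢ab)) (ℤ.*-zeroʳ (f i j))

Harmonic : ℕ → (ℕ → ℕ → ℤ) → Set
Harmonic d f = ∀ a b → a + b < d → f a b ≡ f (suc a) b +ℤ f a (suc b)

move : ℕ → ℕ → Config
move a b i j = (δ (suc a) b i j +ℤ δ a (suc b) i j) -ℤ δ a b i j

split≡+move : ∀ a b w i j → split a b w i j ≡ w i j +ℤ move a b i j
split≡+move a b w i j = reorder (w i j) (δ a b i j) (δ (suc a) b i j) (δ a (suc b) i j)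
  where
  reorder : ∀ x y z t → ((x -ℤ y) +ℤ z) +ℤ t ≡ x +ℤ ((z +ℤ t) -ℤ y)
  reorder = solve-∀

unsplit≡-move : ∀ a b w i j → unsplit a b w i j ≡ w i j -ℤ move a b i j
unsplit≡-move a b w i j = reorder (w i j) (δ a b i j) (δ (suc a) b i j) (δ a (suc b) i j)
  where
  reorder : ∀ x y z t → ((x +ℤ y) -ℤ z) -ℤ t ≡ x -ℤ ((z +ℤ t) -ℤ y)
  reorder = solve-∀

module _ {d : ℕ} {f : ℕ → ℕ → ℤ} (harmonic : Harmonic d f) where

  open Pairing d f

  pairing-move : ∀ {a b} → a + b < d → pairing d f (move a b) ≡ 0ℤ
  pairing-move {a} {b} a+b<d = begin
    pairing d f (move a b)
      ≡⟨ pairing-+ (λ i j → δ (suc a) b i j +ℤ δ a (suc b) i j) (λ i j → - δ a b i j) ⟩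
    pairing d f (λ i j → δ (suc a) b i j +ℤ δ a (suc b) i j) +ℤ pairing d f (λ i j → - δ a b i j)
      ≡⟨ cong₂ _+ℤ_ (pairing-+ (δ (suc a) b) (δ a (suc b))) (pairing-neg (δ a b)) ⟩
    (pairing d f (δ (suc a) b) +ℤ pairing d f (δ a (suc b))) -ℤ pairing d f (δ a b)
      ≡⟨ cong₂ _-ℤ_ (cong₂ _+ℤ_ (pairing-δ a+b<d) (pairing-δ (subst (_≤ d) (sym (ℕ.+-suc a b)) a+b<d)))
                    (trans (pairing-δ (ℕ.<⇒≤ a+b<d)) (harmonic a b a+b<d)) ⟩
    (f (suc a) b +ℤ f a (suc b)) -ℤ (f (suc a) b +ℤ f a (suc b))
      ≡⟨ ℤ.+-inverseʳ (f (suc a) b +ℤ f a (suc b)) ⟩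
    0ℤ ∎
    where open ≡-Reasoning

  pairing-reachable : ∀ {w} → Reachable d w → pairing d f w ≡ 0ℤ
  pairing-reachable base = pairing-zero
  pairing-reachable (spl {w} a b a+b<d reach) = begin
    pairing d f (split a b w)                    ≡⟨ pairing-ext (split≡+move a b w) ⟩
    pairing d f (λ i j → w i j +ℤ move a b i j)  ≡⟨ pairing-+ w (move a b) ⟩
    pairing d f w +ℤ pairing d f (move a b)      ≡⟨ cong₂ _+ℤ_ (pairing-reachable reach) (pairing-move a+b<d) ⟩
    0ℤ ∎
    where open ≡-Reasoning
  pairing-reachable (unspl {w} a b a+b<d reach) = begin
    pairing d f (unsplit a b w)
      ≡⟨ pairing-ext (unsplit≡-move a b w) ⟩
    pairing d f (λ i j → w i j -ℤ move a b i j)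
      ≡⟨ pairing-+ w (λ i j → - move a b i j) ⟩
    pairing d f w +ℤ pairing d f (λ i j → - move a b i j)
      ≡⟨ cong (pairing d f w +ℤ_) (pairing-neg (move a b)) ⟩
    pairing d f w -ℤ pairing d f (move a b)
      ≡⟨ cong₂ _-ℤ_ (pairing-reachable reach) (pairing-move a+b<d) ⟩
    0ℤ ∎
    where open ≡-Reasoning

  pairing-outcome : ∀ {w} → Outcome d w → pairing d f w ≡ 0ℤ
  pairing-outcome (v , reach , w≈v) = trans (pairing-cong w≈v) (pairing-reachable reach)

-- A weight is given by its positive and negative parts, so that pairing
-- identities can be read off in ℕ.
record Weight (d : ℕ) : Set where
  field
    pos neg  : ℕ → ℕ → ℕ
    harmonic : ∀ a b → a + b < d →
               pos a b + neg (suc a) b + neg a (suc b) ≡ neg a b + pos (suc a) b + pos a (suc b)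

  value : ℕ → ℕ → ℤ
  value i j = + pos i j -ℤ + neg i j

  value-harmonic : Harmonic d value
  value-harmonic a b a+b<d = ℤ.i-j≡0⇒i≡j _ _ (begin
    (+ p₀ -ℤ + n₀) -ℤ ((+ p₁ -ℤ + n₁) +ℤ (+ p₂ -ℤ + n₂))
      ≡⟨ regroup (+ p₀) (+ n₀) (+ p₁) (+ n₁) (+ p₂) (+ n₂) ⟩
    (+ p₀ +ℤ + n₁ +ℤ + n₂) -ℤ (+ n₀ +ℤ + p₁ +ℤ + p₂)
      ≡⟨ cong₂ _-ℤ_ (sym (pos-+₃ p₀ n₁ n₂)) (sym (pos-+₃ n₀ p₁ p₂)) ⟩
    + (p₀ + n₁ + n₂) -ℤ + (n₀ + p₁ + p₂)
      ≡⟨ cong (λ x → x -ℤ + (n₀ + p₁ + p₂)) (cong +_ (harmonic a b a+b<d)) ⟩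
    + (n₀ + p₁ + p₂) -ℤ + (n₀ + p₁ + p₂)
      ≡⟨ ℤ.+-inverseʳ (+ (n₀ + p₁ + p₂)) ⟩
    0ℤ ∎)
    where
    open ≡-Reasoning
    p₀ n₀ p₁ n₁ p₂ n₂ : ℕ
    p₀ = pos a b
    n₀ = neg a b
    p₁ = pos (suc a) b
    n₁ = neg (suc a) b
    p₂ = pos a (suc b)
    n₂ = neg a (suc b)
    regroup : ∀ x₀ y₀ x₁ y₁ x₂ y₂ →
      (x₀ -ℤ y₀) -ℤ ((x₁ -ℤ y₁) +ℤ (x₂ -ℤ y₂)) ≡ (x₀ +ℤ y₁ +ℤ y₂) -ℤ (y₀ +ℤ x₁ +ℤ x₂)
    regroup = solve-∀

open Weight public

none one : ℕ → ℕ → ℕ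
none _ _ = 0
one  _ _ = 1

isZero : ℕ → ℕ
isZero zero    = 1
isZero (suc _) = 0

choose₂ : ℕ → ℕ
choose₂ zero    = 0
choose₂ (suc j) = choose₂ j + j

-- With c i j (t) = t^i (1 − t)^j: atHalf is 2^d · c i j (1/2), atZeroₖ is the
-- coefficient of tᵏ in c i j, and atOneₖ the coefficient of sᵏ, where s = 1 − t.
atHalf : ∀ d → Weight d
atHalf d = record { pos = λ i j → 2 ^ (d ∸ (i + j)) ; neg = none ; harmonic = halves }
  where
  halves : ∀ a b → a + b < d → 2 ^ (d ∸ (a + b)) + 0 + 0 ≡ 0 + 2 ^ (d ∸ (suc a + b)) + 2 ^ (d ∸ (a + suc b))
  halves a b a+b<d rewrite ℕ.+-suc a b | ℕ.+-∸-assoc 1 a+b<d = double (2 ^ (d ∸ suc (a + b)))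
    where
    double : ∀ x → 2 * x + 0 + 0 ≡ 0 + x + x
    double = ℕ-Solver.solve-∀

atZero₀ : ∀ {d} → Weight d
atZero₀ {d} = record { pos = p ; neg = none ; harmonic = h }
  where
  p : ℕ → ℕ → ℕ
  p zero    _ = 1
  p (suc _) _ = 0
  h : ∀ a b → a + b < d → p a b + 0 + 0 ≡ 0 + p (suc a) b + p a (suc b)
  h zero    _ _ = refl
  h (suc _) _ _ = refl

atOne₀ : ∀ {d} → Weight d
atOne₀ {d} = record { pos = p ; neg = none ; harmonic = h }
  where
  p : ℕ → ℕ → ℕ
  p _ zero    = 1
  p _ (suc _) = 0
  h : ∀ a b → a + b < d → p a b + 0 + 0 ≡ 0 + p (suc a) b + p a (suc b)
  h _ zero    _ = refl
  h _ (suc _) _ = refl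

atZero₁ : ∀ {d} → Weight d
atZero₁ {d} = record { pos = p ; neg = n ; harmonic = h }
  where
  p n : ℕ → ℕ → ℕ
  p zero    _ = 0
  p (suc i) _ = isZero i
  n zero    j = j
  n (suc _) _ = 0
  h : ∀ a b → a + b < d → p a b + n (suc a) b + n a (suc b) ≡ n a b + p (suc a) b + p a (suc b)
  h zero          b _ = sym (trans (ℕ.+-identityʳ (b + 1)) (ℕ.+-comm b 1))
  h (suc zero)    _ _ = refl
  h (suc (suc _)) _ _ = refl

atOne₁ : ∀ {d} → Weight d
atOne₁ {d} = record { pos = p ; neg = n ; harmonic = h }
  where
  p n : ℕ → ℕ → ℕ
  p _ zero    = 0
  p _ (suc j) = isZero j
  n i zero    = i
  n _ (suc _) = 0
  h : ∀ a b → a + b < d → p a b + n (suc a) b + n a (suc b) ≡ n a b + p (suc a) b + p a (suc b)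
  h a zero          _ = shift a
    where
    shift : ∀ a → suc a + 0 ≡ a + 0 + 1
    shift = ℕ-Solver.solve-∀
  h _ (suc zero)    _ = refl
  h _ (suc (suc _)) _ = refl

atZero₂ : ∀ {d} → Weight d
atZero₂ {d} = record { pos = p ; neg = n ; harmonic = h }
  where
  p n : ℕ → ℕ → ℕ
  p zero          j = choose₂ j
  p (suc zero)    _ = 0
  p (suc (suc i)) _ = isZero i
  n (suc zero) j = j
  n _          _ = 0
  h : ∀ a b → a + b < d → p a b + n (suc a) b + n a (suc b) ≡ n a b + p (suc a) b + p a (suc b)
  h zero                b _ = ℕ.+-identityʳ (choose₂ b + b)
  h (suc zero)          b _ = sym (trans (ℕ.+-identityʳ (b + 1)) (ℕ.+-comm b 1))
  h (suc (suc zero))    _ _ = refl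
  h (suc (suc (suc _))) _ _ = refl

-- An entry (b , k) of the column stands for the mass suc k at (0 , suc b), an
-- entry (a , k) of the row for suc k at (suc a , 0), and ((p , q) , k) in the
-- interior for suc k at (suc p , suc q).
record Support : Set where
  constructor support
  field
    column : List (ℕ × ℕ)
    row    : List (ℕ × ℕ)
    inner  : List ((ℕ × ℕ) × ℕ)

open Support public

onColumn : ℕ → ℕ × ℕ
onColumn b = 0 , suc b

onRow : ℕ → ℕ × ℕ
onRow a = suc a , 0

inside : ℕ × ℕ → ℕ × ℕ
inside pq = suc (proj₁ pq) , suc (proj₂ pq)

mass : {X : Set} → List (X × ℕ) → ℕ
mass []             = 0
mass ((_ , k) ∷ xs) = suc k + mass xs

module _ {X : Set} (at : X → ℕ × ℕ) where

  massesAt : List (X × ℕ) → Config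
  massesAt []             i j = 0ℤ
  massesAt ((x , k) ∷ xs) i j = + suc k *ℤ uncurry δ (at x) i j +ℤ massesAt xs i j

  weigh : (ℕ → ℕ → ℕ) → List (X × ℕ) → ℕ
  weigh g []             = 0
  weigh g ((x , k) ∷ xs) = uncurry g (at x) * suc k + weigh g xs

  WithinAt : ℕ → List (X × ℕ) → Set
  WithinAt d = All λ e → uncurry _+_ (at (proj₁ e)) ≤ d

  pairing-massesAt : ∀ {d} (F : Weight d) xs → WithinAt d xs →
    pairing d (value F) (massesAt xs) ≡ + weigh (pos F) xs -ℤ + weigh (neg F) xs
  pairing-massesAt {d} F [] [] = Pairing.pairing-zero d (value F)
  pairing-massesAt {d} F ((x , k) ∷ xs) (x∈d ∷ xs∈d) = begin
    pairing d (value F) (massesAt ((x , k) ∷ xs))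
      ≡⟨ pairing-+ (λ i j → + suc k *ℤ uncurry δ (at x) i j) (massesAt xs) ⟩
    pairing d (value F) (λ i j → + suc k *ℤ uncurry δ (at x) i j) +ℤ pairing d (value F) (massesAt xs)
      ≡⟨ cong₂ _+ℤ_ (trans (pairing-* (+ suc k) (uncurry δ (at x))) (cong (+ suc k *ℤ_) (pairing-δ x∈d)))
                    (pairing-massesAt F xs xs∈d) ⟩
    + suc k *ℤ (+ p -ℤ + n) +ℤ (+ P -ℤ + N)
      ≡⟨ regroup (+ suc k) (+ p) (+ n) (+ P) (+ N) ⟩
    (+ p *ℤ + suc k +ℤ + P) -ℤ (+ n *ℤ + suc k +ℤ + N)
      ≡⟨ cong₂ _-ℤ_ (sym (pos-*-+ p (suc k) P)) (sym (pos-*-+ n (suc k) N)) ⟩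
    + (p * suc k + P) -ℤ + (n * suc k + N) ∎
    where
    open ≡-Reasoning
    open Pairing d (value F)
    p n P N : ℕ
    p = uncurry (pos F) (at x)
    n = uncurry (neg F) (at x)
    P = weigh (pos F) xs
    N = weigh (neg F) xs
    regroup : ∀ k x y X Y → k *ℤ (x -ℤ y) +ℤ (X -ℤ Y) ≡ (x *ℤ k +ℤ X) -ℤ (y *ℤ k +ℤ Y)
    regroup = solve-∀

masses : Support → Config
masses s i j = massesAt onColumn (column s) i j +ℤ massesAt onRow (row s) i j +ℤ massesAt inside (inner s) i j

config : ℤ → Support → Config
config c s i j = c *ℤ δ 0 0 i j +ℤ masses s i j

weighs : (ℕ → ℕ → ℕ) → Support → ℕ
weighs g s = weigh onColumn g (column s) + weigh onRow g (row s) + weigh inside g (inner s)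

Within : ℕ → Support → Set
Within d s = WithinAt onColumn d (column s) × WithinAt onRow d (row s) × WithinAt inside d (inner s)

Balanced : ∀ {d} → Weight d → ℕ → ℕ → Support → Set
Balanced F n₁ n₂ s =
  pos F 0 0 * n₁ + neg F 0 0 * n₂ + weighs (pos F) s ≡ neg F 0 0 * n₁ + pos F 0 0 * n₂ + weighs (neg F) s

module _ {d : ℕ} (F : Weight d) where

  open Pairing d (value F)

  pairing-masses : ∀ s → Within d s → pairing d (value F) (masses s) ≡ + weighs (pos F) s -ℤ + weighs (neg F) s
  pairing-masses s (c∈d , r∈d , i∈d) = begin
    pairing d (value F) (masses s)
      ≡⟨ trans (pairing-+ _ (massesAt inside (inner s)))
               (cong (_+ℤ pairing d (value F) (massesAt inside (inner s))) (pairing-+ _ _)) ⟩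
    pairing d (value F) (massesAt onColumn (column s)) +ℤ pairing d (value F) (massesAt onRow (row s))
      +ℤ pairing d (value F) (massesAt inside (inner s))
      ≡⟨ cong₂ _+ℤ_ (cong₂ _+ℤ_ (pairing-massesAt onColumn F _ c∈d) (pairing-massesAt onRow F _ r∈d))
                    (pairing-massesAt inside F _ i∈d) ⟩
    (+ Pc -ℤ + Nc) +ℤ (+ Pr -ℤ + Nr) +ℤ (+ Pi -ℤ + Ni)
      ≡⟨ regroup (+ Pc) (+ Nc) (+ Pr) (+ Nr) (+ Pi) (+ Ni) ⟩
    (+ Pc +ℤ + Pr +ℤ + Pi) -ℤ (+ Nc +ℤ + Nr +ℤ + Ni)
      ≡⟨ cong₂ _-ℤ_ (sym (pos-+₃ Pc Pr Pi)) (sym (pos-+₃ Nc Nr Ni)) ⟩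
    + weighs (pos F) s -ℤ + weighs (neg F) s ∎
    where
    open ≡-Reasoning
    Pc Nc Pr Nr Pi Ni : ℕ
    Pc = weigh onColumn (pos F) (column s)
    Nc = weigh onColumn (neg F) (column s)
    Pr = weigh onRow (pos F) (row s)
    Nr = weigh onRow (neg F) (row s)
    Pi = weigh inside (pos F) (inner s)
    Ni = weigh inside (neg F) (inner s)
    regroup : ∀ a b c e f g → (a -ℤ b) +ℤ (c -ℤ e) +ℤ (f -ℤ g) ≡ (a +ℤ c +ℤ f) -ℤ (b +ℤ e +ℤ g)
    regroup = solve-∀

  pairing-config : ∀ c s → Within d s →
    pairing d (value F) (config c s) ≡ c *ℤ value F 0 0 +ℤ (+ weighs (pos F) s -ℤ + weighs (neg F) s)
  pairing-config c s s∈d = trans (pairing-+ (λ i j → c *ℤ δ 0 0 i j) (masses s))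
    (cong₂ _+ℤ_ (trans (pairing-* c (δ 0 0)) (cong (c *ℤ_) (pairing-δ z≤n))) (pairing-masses s s∈d))

  balanced : ∀ {w c s n₁ n₂} → Outcome d w → w ≈[ d ] config c s → Within d s → c ≡ + n₁ -ℤ + n₂ →
             Balanced F n₁ n₂ s
  balanced {w} {c} {s} {n₁} {n₂} outcome w≈s s∈d c≡n₁-n₂ = ℤ.+-injective (ℤ.i-j≡0⇒i≡j _ _ (begin
    + (p * n₁ + q * n₂ + P) -ℤ + (q * n₁ + p * n₂ + Q)
      ≡⟨ cong₂ _-ℤ_ (pos-lin p n₁ q n₂ P) (pos-lin q n₁ p n₂ Q) ⟩
    (+ p *ℤ + n₁ +ℤ + q *ℤ + n₂ +ℤ + P) -ℤ (+ q *ℤ + n₁ +ℤ + p *ℤ + n₂ +ℤ + Q)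
      ≡⟨ regroup (+ p) (+ q) (+ n₁) (+ n₂) (+ P) (+ Q) ⟩
    (+ n₁ -ℤ + n₂) *ℤ value F 0 0 +ℤ (+ P -ℤ + Q)
      ≡⟨ cong (λ x → x *ℤ value F 0 0 +ℤ (+ P -ℤ + Q)) (sym c≡n₁-n₂) ⟩
    c *ℤ value F 0 0 +ℤ (+ P -ℤ + Q)
      ≡⟨ sym (pairing-config c s s∈d) ⟩
    pairing d (value F) (config c s)
      ≡⟨ sym (pairing-cong w≈s) ⟩
    pairing d (value F) w
      ≡⟨ pairing-outcome (value-harmonic F) outcome ⟩
    0ℤ ∎))
    where
    open ≡-Reasoning
    p q P Q : ℕ
    p = pos F 0 0
    q = neg F 0 0
    P = weighs (pos F) s
    Q = weighs (neg F) s
    pos-lin : ∀ x y z t u → + (x * y + z * t + u) ≡ + x *ℤ + y +ℤ + z *ℤ + t +ℤ + u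
    pos-lin x y z t u = trans (ℤ.pos-+ (x * y + z * t) u)
      (cong (_+ℤ + u) (trans (ℤ.pos-+ (x * y) (z * t)) (cong₂ _+ℤ_ (ℤ.pos-* x y) (ℤ.pos-* z t))))
    regroup : ∀ x y m₁ m₂ X Y →
      (x *ℤ m₁ +ℤ y *ℤ m₂ +ℤ X) -ℤ (y *ℤ m₁ +ℤ x *ℤ m₂ +ℤ Y) ≡ (m₁ -ℤ m₂) *ℤ (x -ℤ y) +ℤ (X -ℤ Y)
    regroup = solve-∀

size : Support → ℕ
size s = length (column s) + length (row s) + length (inner s)

-- The origin is not a mass site (its entry is the c of config c), hence the first clause.
insert : ℕ → ℕ → ℕ → Support → Support
insert zero    zero    _ s = s
insert zero    (suc b) k s = record s { column = (b , k) ∷ column s }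
insert (suc a) zero    k s = record s { row = (a , k) ∷ row s }
insert (suc a) (suc b) k s = record s { inner = ((a , b) , k) ∷ inner s }

config-insert : ∀ a b k c s i j → (a , b) ≢ (0 , 0) →
  config c (insert a b k s) i j ≡ config c s i j +ℤ + suc k *ℤ δ a b i j
config-insert zero    zero    k c s i j ab≢00 = ⊥-elim (ab≢00 refl)
config-insert zero    (suc b) k c s i j _ =
  onFirst (c *ℤ δ 0 0 i j) (+ suc k *ℤ δ zero (suc b) i j) (massesAt onColumn (column s) i j)
    (massesAt onRow (row s) i j) (massesAt inside (inner s) i j)
  where
  onFirst : ∀ o x y z t → o +ℤ ((x +ℤ y) +ℤ z +ℤ t) ≡ o +ℤ (y +ℤ z +ℤ t) +ℤ x
  onFirst = solve-∀
config-insert (suc a) zero    k c s i j _ =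
  onSecond (c *ℤ δ 0 0 i j) (+ suc k *ℤ δ (suc a) zero i j) (massesAt onColumn (column s) i j)
    (massesAt onRow (row s) i j) (massesAt inside (inner s) i j)
  where
  onSecond : ∀ o x y z t → o +ℤ (y +ℤ (x +ℤ z) +ℤ t) ≡ o +ℤ (y +ℤ z +ℤ t) +ℤ x
  onSecond = solve-∀
config-insert (suc a) (suc b) k c s i j _ =
  onThird (c *ℤ δ 0 0 i j) (+ suc k *ℤ δ (suc a) (suc b) i j) (massesAt onColumn (column s) i j)
    (massesAt onRow (row s) i j) (massesAt inside (inner s) i j)
  where
  onThird : ∀ o x y z t → o +ℤ (y +ℤ z +ℤ (x +ℤ t)) ≡ o +ℤ (y +ℤ z +ℤ t) +ℤ x
  onThird = solve-∀

size-insert : ∀ a b k s → size (insert a b k s) ≤ suc (size s)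
size-insert zero    zero    k s = ℕ.n≤1+n (size s)
size-insert zero    (suc b) k s = ℕ.≤-refl
size-insert (suc a) zero    k s =
  ℕ.≤-reflexive (cong (_+ length (inner s)) (ℕ.+-suc (length (column s)) (length (row s))))
size-insert (suc a) (suc b) k s = ℕ.≤-reflexive (ℕ.+-suc (length (column s) + length (row s)) (length (inner s)))

within-insert : ∀ {d} a b k s → a + b ≤ d → Within d s → Within d (insert a b k s)
within-insert zero    zero    k s _    s∈d                 = s∈d
within-insert zero    (suc b) k s ab≤d (c∈d , r∈d , i∈d) = ab≤d ∷ c∈d , r∈d , i∈d
within-insert (suc a) zero    k s ab≤d (c∈d , r∈d , i∈d) = c∈d , ab≤d ∷ r∈d , i∈d
within-insert (suc a) (suc b) k s ab≤d (c∈d , r∈d , i∈d) = c∈d , r∈d , ab≤d ∷ i∈d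

erase : ℕ → ℕ → Config → Config
erase a b w i j = w i j -ℤ w a b *ℤ δ a b i j

module _ (a b : ℕ) (w : Config) where

  erase-diag : erase a b w a b ≡ 0ℤ
  erase-diag = trans (cong (λ x → w a b -ℤ w a b *ℤ x) (δ-diag a b))
                     (trans (cong (w a b -ℤ_) (ℤ.*-identityʳ (w a b))) (ℤ.+-inverseʳ (w a b)))

  erase-off : ∀ {i j} → (i , j) ≢ (a , b) → erase a b w i j ≡ w i j
  erase-off {i} {j} ij≢ab = trans (cong (λ x → w i j -ℤ w a b *ℤ x) (δ-off ij≢ab))
                                  (trans (cong (w i j -ℤ_) (ℤ.*-zeroʳ (w a b))) (ℤ.+-identityʳ (w i j)))

  erase-restore : ∀ i j → w i j ≡ erase a b w i j +ℤ w a b *ℤ δ a b i j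
  erase-restore i j = restore (w i j) (w a b *ℤ δ a b i j)
    where
    restore : ∀ x y → x ≡ x -ℤ y +ℤ y
    restore = solve-∀

PositivesIn : ℕ → Config → List (ℕ × ℕ) → Set
PositivesIn d w L = ∀ i j → i + j ≤ d → (i , j) ≢ (0 , 0) → 0ℤ <ℤ w i j → (i , j) ∈ L

_≟₂_ : (p q : ℕ × ℕ) → Dec (p ≡ q)
_≟₂_ = ≡-dec ℕ._≟_ ℕ._≟_

MassAt : ℕ → Config → ℕ → ℕ → Set
MassAt d w a b = a + b ≤ d × (a , b) ≢ (0 , 0) × Σ ℕ λ k → w a b ≡ + suc k

mass-or-not : ∀ {d w} a b → Valid d w →
  MassAt d w a b ⊎ (a + b ≤ d → (a , b) ≢ (0 , 0) → ¬ (0ℤ <ℤ w a b))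
mass-or-not {d} {w} a b valid with (a , b) ≟₂ (0 , 0) | a + b ≤? d | w a b in w[ab]
... | yes ab≡00 | _         | _        = inj₂ λ _ ab≢00 _ → ab≢00 ab≡00
... | no _      | no ab≰d   | _        = inj₂ λ ab≤d _ _ → ab≰d ab≤d
... | no _      | yes _     | + zero   = inj₂ λ _ _ 0<w[ab] → ℤ.<-irrefl refl 0<w[ab]
... | no ab≢00  | yes ab≤d  | + suc k  = inj₁ (ab≤d , ab≢00 , k , refl)
... | no ab≢00  | yes ab≤d  | -[1+ k ] with subst (0ℤ ≤ℤ_) w[ab] (valid a b ab≤d ab≢00)
...   | ()

Decomposition : ℕ → Config → ℕ → Set
Decomposition d w n = Σ Support λ s → size s ≤ n × Within d s × w ≈[ d ] config (w 0 0) s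

origin-only : ∀ {d w} → Valid d w → PositivesIn d w [] → Decomposition d w 0
origin-only {d} {w} valid positives = support [] [] [] , z≤n , ([] , [] , []) , w≈origin
  where
  w≈origin : w ≈[ d ] config (w 0 0) (support [] [] [])
  w≈origin i j ij≤d with (i , j) ≟₂ (0 , 0)
  ... | yes refl  = sym (trans (ℤ.+-identityʳ _) (trans (cong (w 0 0 *ℤ_) (δ-diag 0 0)) (ℤ.*-identityʳ (w 0 0))))
  ... | no ij≢00 = trans (ℤ.≤-antisym (ℤ.≮⇒≥ λ 0<w → case positives i j ij≤d ij≢00 0<w of λ ())
                                       (valid i j ij≤d ij≢00))
                         (sym (trans (ℤ.+-identityʳ _) (trans (cong (w 0 0 *ℤ_) (δ-off ij≢00)) (ℤ.*-zeroʳ (w 0 0)))))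

decompose : ∀ {d w} L → Valid d w → PositivesIn d w L → Decomposition d w (length L)
decompose []            valid positives = origin-only valid positives
decompose {d} {w} ((a , b) ∷ L) valid positives with mass-or-not a b valid
... | inj₂ no-mass =
  let s , size≤ , s∈d , w≈s = decompose L valid positives-in-L
  in s , ℕ.m≤n⇒m≤1+n size≤ , s∈d , w≈s
  where
  positives-in-L : PositivesIn d w L
  positives-in-L i j ij≤d ij≢00 0<w with positives i j ij≤d ij≢00 0<w
  ... | here refl = ⊥-elim (no-mass ij≤d ij≢00 0<w)
  ... | there ij∈L = ij∈L
... | inj₁ (ab≤d , ab≢00 , k , w[ab]) =
  let s , size≤ , s∈d , rest≈s = decompose L erase-valid erase-positives
  in insert a b k s , ℕ.≤-trans (size-insert a b k s) (s≤s size≤) , within-insert a b k s ab≤d s∈d ,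
     λ i j ij≤d → begin
       w i j
         ≡⟨ erase-restore a b w i j ⟩
       erase a b w i j +ℤ w a b *ℤ δ a b i j
         ≡⟨ cong₂ _+ℤ_ (rest≈s i j ij≤d) (cong (λ x → x *ℤ δ a b i j) w[ab]) ⟩
       config (erase a b w 0 0) s i j +ℤ + suc k *ℤ δ a b i j
         ≡⟨ cong (λ c → config c s i j +ℤ + suc k *ℤ δ a b i j) (erase-off a b w (ab≢00 ∘ sym)) ⟩
       config (w 0 0) s i j +ℤ + suc k *ℤ δ a b i j
         ≡⟨ sym (config-insert a b k (w 0 0) s i j ab≢00) ⟩
       config (w 0 0) (insert a b k s) i j ∎
  where
  open ≡-Reasoning
  erase-valid : Valid d (erase a b w)
  erase-valid i j ij≤d ij≢00 with (i , j) ≟₂ (a , b)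
  ... | yes refl  = ℤ.≤-reflexive (sym (erase-diag a b w))
  ... | no ij≢ab = subst (0ℤ ≤ℤ_) (sym (erase-off a b w ij≢ab)) (valid i j ij≤d ij≢00)
  erase-positives : PositivesIn d (erase a b w) L
  erase-positives i j ij≤d ij≢00 0<e with (i , j) ≟₂ (a , b)
  ... | yes refl = ⊥-elim (ℤ.<-irrefl (sym (erase-diag a b w)) 0<e)
  ... | no ij≢ab with positives i j ij≤d ij≢00 (subst (0ℤ <ℤ_) (erase-off a b w ij≢ab) 0<e)
  ...   | here ij≡ab  = ⊥-elim (ij≢ab ij≡ab)
  ...   | there ij∈L = ij∈L

module _ {X : Set} (at : X → ℕ × ℕ) where

  weigh-cong : ∀ {g h} → (∀ x → uncurry g (at x) ≡ uncurry h (at x)) → ∀ xs → weigh at g xs ≡ weigh at h xs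
  weigh-cong g≗h []             = refl
  weigh-cong g≗h ((x , k) ∷ xs) = cong₂ (λ v w → v * suc k + w) (g≗h x) (weigh-cong g≗h xs)

  weigh-zero : ∀ {g} → (∀ x → uncurry g (at x) ≡ 0) → ∀ xs → weigh at g xs ≡ 0
  weigh-zero g≗0 xs = trans (weigh-cong g≗0 xs) (zeros xs)
    where
    zeros : ∀ xs → weigh at none xs ≡ 0
    zeros []       = refl
    zeros (_ ∷ xs) = zeros xs

  weigh-one : ∀ {g} → (∀ x → uncurry g (at x) ≡ 1) → ∀ xs → weigh at g xs ≡ mass xs
  weigh-one g≗1 xs = trans (weigh-cong g≗1 xs) (ones xs)
    where
    ones : ∀ xs → weigh at one xs ≡ mass xs
    ones []             = refl
    ones ((_ , k) ∷ xs) = cong₂ _+_ (ℕ.*-identityˡ (suc k)) (ones xs)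

  weigh-mono : ∀ {g h} → (∀ x → uncurry g (at x) ≤ uncurry h (at x)) → ∀ xs → weigh at g xs ≤ weigh at h xs
  weigh-mono g≤h []             = z≤n
  weigh-mono g≤h ((x , k) ∷ xs) = ℕ.+-mono-≤ (ℕ.*-monoˡ-≤ (suc k) (g≤h x)) (weigh-mono g≤h xs)

  weigh-rigid : ∀ {g h} → (∀ x → uncurry g (at x) ≤ uncurry h (at x)) → ∀ xs →
                weigh at g xs ≡ weigh at h xs → All (λ e → uncurry g (at (proj₁ e)) ≡ uncurry h (at (proj₁ e))) xs
  weigh-rigid g≤h []             _  = []
  weigh-rigid g≤h ((x , k) ∷ xs) eq =
    let heads , tails = +-rigid (ℕ.*-monoˡ-≤ (suc k) (g≤h x)) (weigh-mono g≤h xs) eq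
    in ℕ.*-cancelʳ-≡ _ _ (suc k) heads ∷ weigh-rigid g≤h xs tails
    where
    +-rigid : ∀ {u v y z} → u ≤ y → v ≤ z → u + v ≡ y + z → u ≡ y × v ≡ z
    +-rigid {u} {v} {y} {z} u≤y v≤z eq =
      let u≡y = ℕ.≤-antisym u≤y (ℕ.+-cancelʳ-≤ v y u (ℕ.≤-trans (ℕ.+-monoʳ-≤ y v≤z) (ℕ.≤-reflexive (sym eq))))
      in u≡y , ℕ.+-cancelˡ-≡ u v z (trans eq (cong (_+ z) (sym u≡y)))

  weigh-positive : ∀ {g} → (∀ i j → 0 < g i j) → ∀ xs → weigh at g xs ≡ 0 → xs ≡ []
  weigh-positive g>0 []             _  = refl
  weigh-positive g>0 ((x , k) ∷ xs) eq =
    ⊥-elim (ℕ.<⇒≢ (ℕ.*-monoˡ-< (suc k) (g>0 _ _)) (sym (ℕ.m+n≡0⇒m≡0 _ eq)))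

weighs-none : ∀ s → weighs none s ≡ 0
weighs-none s = cong₂ _+_ (cong₂ _+_ (weigh-zero onColumn (λ _ → refl) (column s))
                                     (weigh-zero onRow (λ _ → refl) (row s)))
                          (weigh-zero inside (λ _ → refl) (inner s))

module _ {d : ℕ} (n : ℕ) (s : Support) where

  column-mass : Balanced (atZero₀ {d}) 0 (suc n) s → mass (column s) ≡ suc n
  column-mass balance = begin
    mass (column s)
      ≡⟨ sym (trans (ℕ.+-identityʳ _) (ℕ.+-identityʳ _)) ⟩
    mass (column s) + 0 + 0
      ≡⟨ sym (cong₂ _+_ (cong₂ _+_ (weigh-one onColumn (λ _ → refl) (column s))
                                   (weigh-zero onRow (λ _ → refl) (row s)))
                        (weigh-zero inside (λ _ → refl) (inner s))) ⟩
    weighs (pos (atZero₀ {d})) s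
      ≡⟨ balance ⟩
    1 * suc n + weighs none s
      ≡⟨ cong (_+_ (1 * suc n)) (weighs-none s) ⟩
    1 * suc n + 0
      ≡⟨ trans (ℕ.+-identityʳ _) (ℕ.*-identityˡ _) ⟩
    suc n ∎
    where open ≡-Reasoning

  row-mass : Balanced (atOne₀ {d}) 0 (suc n) s → mass (row s) ≡ suc n
  row-mass balance = begin
    mass (row s)
      ≡⟨ sym (ℕ.+-identityʳ _) ⟩
    0 + mass (row s) + 0
      ≡⟨ sym (cong₂ _+_ (cong₂ _+_ (weigh-zero onColumn (λ _ → refl) (column s))
                                   (weigh-one onRow (λ _ → refl) (row s)))
                        (weigh-zero inside (λ _ → refl) (inner s))) ⟩
    weighs (pos (atOne₀ {d})) s
      ≡⟨ balance ⟩
    1 * suc n + weighs none s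
      ≡⟨ cong (_+_ (1 * suc n)) (weighs-none s) ⟩
    1 * suc n + 0
      ≡⟨ trans (ℕ.+-identityʳ _) (ℕ.*-identityˡ _) ⟩
    suc n ∎
    where open ≡-Reasoning

atHalf-positive : ∀ d i j → 0 < pos (atHalf d) i j
atHalf-positive d i j = ℕ.m^n>0 2 (d ∸ (i + j))

halving-total : ∀ d n s → Balanced (atHalf d) n 0 s → 2 ^ d * n + weighs (pos (atHalf d)) s ≡ 0
halving-total d n s balance = begin
  2 ^ d * n + weighs (pos (atHalf d)) s      ≡⟨ cong (_+ weighs (pos (atHalf d)) s) (sym (ℕ.+-identityʳ (2 ^ d * n))) ⟩
  2 ^ d * n + 0 + weighs (pos (atHalf d)) s  ≡⟨ balance ⟩
  2 ^ d * 0 + weighs none s                  ≡⟨ cong₂ _+_ (ℕ.*-zeroʳ (2 ^ d)) (weighs-none s) ⟩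
  0 ∎
  where open ≡-Reasoning

nonnegative-origin : ∀ d n s → Balanced (atHalf d) n 0 s → n ≡ 0 × s ≡ support [] [] []
nonnegative-origin d n s@(support col row ins) balance =
  vanish (zero-sum (2 ^ d * n) Wc Wr Wi (halving-total d n s balance))
  where
  Wc Wr Wi : ℕ
  Wc = weigh onColumn (pos (atHalf d)) col
  Wr = weigh onRow (pos (atHalf d)) row
  Wi = weigh inside (pos (atHalf d)) ins
  zero-sum : ∀ a b c e → a + (b + c + e) ≡ 0 → a ≡ 0 × b ≡ 0 × c ≡ 0 × e ≡ 0
  zero-sum zero zero zero zero _ = refl , refl , refl , refl
  vanish : 2 ^ d * n ≡ 0 × Wc ≡ 0 × Wr ≡ 0 × Wi ≡ 0 → n ≡ 0 × s ≡ support [] [] []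
  vanish (2^d*n≡0 , Wc≡0 , Wr≡0 , Wi≡0)
    with weigh-positive onColumn (atHalf-positive d) col Wc≡0
       | weigh-positive onRow    (atHalf-positive d) row Wr≡0
       | weigh-positive inside   (atHalf-positive d) ins Wi≡0
  ... | refl | refl | refl = ℕ.m*n≡0⇒m≡0 n (2 ^ d) {{ℕ.m^n≢0 2 d}} (trans (ℕ.*-comm n (2 ^ d)) 2^d*n≡0) , refl

isZero≤1 : ∀ a → isZero a ≤ 1
isZero≤1 zero    = s≤s z≤n
isZero≤1 (suc _) = z≤n

isZero≡1⇒≡0 : ∀ {a} → isZero a ≡ 1 → a ≡ 0
isZero≡1⇒≡0 {zero} _ = refl

-- Under the order-1 weight at t = 0 each column mass weighs at least its size
-- and each row mass at most its size; both totals are N, so every bound is tight.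
unit-sites : ∀ {d n} col row → let s = support col row [] in
  Balanced (atZero₀ {d}) 0 (suc n) s → Balanced (atOne₀ {d}) 0 (suc n) s → Balanced (atZero₁ {d}) 0 (suc n) s →
  All (λ e → proj₁ e ≡ 0) col × All (λ e → proj₁ e ≡ 0) row
unit-sites {d} {n} col row balance₀ balance₁ slope =
  All.map (λ 1≡1+b → ℕ.suc-injective (sym 1≡1+b)) (weigh-rigid onColumn {g = one} (λ _ → s≤s z≤n) col column-tight) ,
  All.map isZero≡1⇒≡0 (weigh-rigid onRow {h = one} (λ x → isZero≤1 x) row row-tight)
  where
  open ≡-Reasoning
  s : Support
  s = support col row []
  Wc Wr : ℕ
  Wc = weigh onColumn (neg (atZero₁ {d})) col
  Wr = weigh onRow (pos (atZero₁ {d})) row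
  Wr≡Wc : Wr ≡ Wc
  Wr≡Wc = begin
    Wr                            ≡⟨ sym (ℕ.+-identityʳ Wr) ⟩
    0 + Wr + 0                    ≡⟨ cong (λ x → x + Wr + 0) (sym (weigh-zero onColumn (λ _ → refl) col)) ⟩
    weighs (pos (atZero₁ {d})) s  ≡⟨ slope ⟩
    weighs (neg (atZero₁ {d})) s  ≡⟨ cong (λ x → Wc + x + 0) (weigh-zero onRow (λ _ → refl) row) ⟩
    Wc + 0 + 0                    ≡⟨ trans (ℕ.+-identityʳ _) (ℕ.+-identityʳ Wc) ⟩
    Wc                            ∎
  mass≤Wc : mass col ≤ Wc
  mass≤Wc = subst (_≤ Wc) (weigh-one onColumn (λ _ → refl) col) (weigh-mono onColumn {g = one} (λ _ → s≤s z≤n) col)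
  Wr≤mass : Wr ≤ mass row
  Wr≤mass = subst (Wr ≤_) (weigh-one onRow (λ _ → refl) row) (weigh-mono onRow {h = one} (λ x → isZero≤1 x) row)
  mass-col≡mass-row : mass col ≡ mass row
  mass-col≡mass-row = trans (column-mass {d} n s balance₀) (sym (row-mass {d} n s balance₁))
  column-tight : weigh onColumn one col ≡ Wc
  column-tight = trans (weigh-one onColumn (λ _ → refl) col)
    (ℕ.≤-antisym mass≤Wc (subst (Wc ≤_) (sym mass-col≡mass-row) (subst (_≤ mass row) Wr≡Wc Wr≤mass)))
  row-tight : Wr ≡ weigh onRow one row
  row-tight = trans (ℕ.≤-antisym Wr≤mass
                      (subst (_≤ Wr) mass-col≡mass-row (subst (mass col ≤_) (sym Wr≡Wc) mass≤Wc)))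
                    (sym (weigh-one onRow (λ _ → refl) row))

massesAt-single-site : ∀ {X} (at : X → ℕ × ℕ) {p} xs → All (λ e → at (proj₁ e) ≡ p) xs →
                       ∀ i j → massesAt at xs i j ≡ + mass xs *ℤ uncurry δ p i j
massesAt-single-site at []             []           i j = refl
massesAt-single-site at {p} ((x , k) ∷ xs) (refl ∷ at≡p) i j = begin
  + suc k *ℤ uncurry δ p i j +ℤ massesAt at xs i j
    ≡⟨ cong (_+ℤ_ (+ suc k *ℤ uncurry δ p i j)) (massesAt-single-site at xs at≡p i j) ⟩
  + suc k *ℤ uncurry δ p i j +ℤ + mass xs *ℤ uncurry δ p i j
    ≡⟨ sym (ℤ.*-distribʳ-+ (uncurry δ p i j) (+ suc k) (+ mass xs)) ⟩
  (+ suc k +ℤ + mass xs) *ℤ uncurry δ p i j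
    ≡⟨ cong (_*ℤ uncurry δ p i j) (sym (ℤ.pos-+ (suc k) (mass xs))) ⟩
  + (suc k + mass xs) *ℤ uncurry δ p i j ∎
  where open ≡-Reasoning

pointSum : List (ℕ × ℕ × ℤ) → Config
pointSum []                   i j = 0ℤ
pointSum ((a , b , v) ∷ rest) i j = v *ℤ δ a b i j +ℤ pointSum rest i j

-- entries reads off the first matching point, pointSum adds all of them; they
-- agree when no point reappears later in the list.
Separated : List (ℕ × ℕ × ℤ) → Set
Separated []                   = ⊤
Separated ((a , b , _) ∷ rest) = pointSum rest a b ≡ 0ℤ × Separated rest

entries≗pointSum : ∀ L → Separated L → ∀ i j → entries L i j ≡ pointSum L i j
entries≗pointSum []                   _                  i j = refl
entries≗pointSum ((a , b , v) ∷ rest) (rest[ab]≡0 , sep) i j with (i ≡ᵇ a) ∧ (j ≡ᵇ b) in match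
... | true  with ≡ᵇ∧≡ᵇ⇒≡ {i} {j} {a} {b} match
...   | refl = sym (trans (cong₂ _+ℤ_ (ℤ.*-identityʳ v) rest[ab]≡0) (ℤ.+-identityʳ v))
entries≗pointSum ((a , b , v) ∷ rest) (_ , sep) i j | false =
  sym (trans (cong (_+ℤ pointSum rest i j) (ℤ.*-zeroʳ v))
             (trans (ℤ.+-identityˡ (pointSum rest i j)) (sym (entries≗pointSum rest sep i j))))

BasicMultiple : Config → Set
BasicMultiple v = Σ ℕ λ k → Σ Config λ u → u ∈ Basic × (∀ i j → v i j ≡ scale k u i j)

basic-multiple : ∀ {v} k u {L} → u ∈ Basic → (∀ i j → u i j ≡ entries L i j) → Separated L →
                 (∀ i j → v i j ≡ + k *ℤ pointSum L i j) → BasicMultiple v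
basic-multiple k u {L} u∈Basic u≗L separated v≗kL = k , u , u∈Basic , λ i j →
  trans (v≗kL i j) (cong (+ k *ℤ_) (sym (trans (u≗L i j) (entries≗pointSum L separated i j))))

out1-multiple : ∀ n col row → mass col ≡ suc n → mass row ≡ suc n →
  All (λ e → proj₁ e ≡ 0) col → All (λ e → proj₁ e ≡ 0) row → BasicMultiple (config -[1+ n ] (support col row []))
out1-multiple n col row col≡n row≡n col-unit row-unit =
  basic-multiple (suc n) out1 (here refl) (λ _ _ → refl) (refl , refl , refl , tt) λ i j → begin
    -[1+ n ] *ℤ δ 0 0 i j +ℤ (massesAt onColumn col i j +ℤ massesAt onRow row i j +ℤ 0ℤ)
      ≡⟨ cong (λ x → -[1+ n ] *ℤ δ 0 0 i j +ℤ (x +ℤ 0ℤ))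
              (cong₂ _+ℤ_ (massesAt-single-site onColumn col (All.map (cong onColumn) col-unit) i j)
                          (massesAt-single-site onRow row (All.map (cong onRow) row-unit) i j)) ⟩
    -[1+ n ] *ℤ δ 0 0 i j +ℤ (+ mass col *ℤ δ 0 1 i j +ℤ + mass row *ℤ δ 1 0 i j +ℤ 0ℤ)
      ≡⟨ cong₂ (λ x y → -[1+ n ] *ℤ δ 0 0 i j +ℤ (+ x *ℤ δ 0 1 i j +ℤ + y *ℤ δ 1 0 i j +ℤ 0ℤ)) col≡n row≡n ⟩
    - + suc n *ℤ δ 0 0 i j +ℤ (+ suc n *ℤ δ 0 1 i j +ℤ + suc n *ℤ δ 1 0 i j +ℤ 0ℤ)
      ≡⟨ regroup (+ suc n) (δ 0 0 i j) (δ 1 0 i j) (δ 0 1 i j) ⟩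
    + suc n *ℤ (-1ℤ *ℤ δ 0 0 i j +ℤ (1ℤ *ℤ δ 1 0 i j +ℤ (1ℤ *ℤ δ 0 1 i j +ℤ 0ℤ))) ∎
  where
  open ≡-Reasoning
  regroup : ∀ x u v w → - x *ℤ u +ℤ (x *ℤ w +ℤ x *ℤ v +ℤ 0ℤ) ≡ x *ℤ (-1ℤ *ℤ u +ℤ (1ℤ *ℤ v +ℤ (1ℤ *ℤ w +ℤ 0ℤ)))
  regroup = solve-∀

singletons : ℕ → ℕ → ℕ → ℕ → ℕ → ℕ → Support
singletons b a p q n m = support ((b , n) ∷ []) ((a , n) ∷ []) (((p , q) , m) ∷ [])

module _ {d : ℕ} (b a p q n m : ℕ)
         (balanced : ∀ (F : Weight d) → Balanced F 0 (suc n) (singletons b a p q n m)) where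

  private
    N M : ℕ
    N = suc n
    M = suc m

  singletons-balance : (F : Weight d) →
    neg F 0 0 * N + (pos F 0 (suc b) * N + pos F (suc a) 0 * N + pos F (suc p) (suc q) * M)
    ≡ pos F 0 0 * N + (neg F 0 (suc b) * N + neg F (suc a) 0 * N + neg F (suc p) (suc q) * M)
  singletons-balance F =
    trans (sym (tidy (pos F) (neg F))) (trans (balanced F) (tidy (neg F) (pos F)))
    where
    rearrange : ∀ o o′ c r i N M → o * 0 + o′ * N + (c * N + 0 + (r * N + 0) + (i * M + 0))
                                   ≡ o′ * N + (c * N + r * N + i * M)
    rearrange = ℕ-Solver.solve-∀
    tidy : ∀ (g h : ℕ → ℕ → ℕ) →
      g 0 0 * 0 + h 0 0 * N + (g 0 (suc b) * N + 0 + (g (suc a) 0 * N + 0) + (g (suc p) (suc q) * M + 0))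
      ≡ h 0 0 * N + (g 0 (suc b) * N + g (suc a) 0 * N + g (suc p) (suc q) * M)
    tidy g h = rearrange (g 0 0) (h 0 0) (g 0 (suc b)) (g (suc a) 0) (g (suc p) (suc q)) N M

  column-slope : isZero a * N + isZero p * M ≡ suc b * N
  column-slope = trans (singletons-balance atZero₁) (trans (ℕ.+-identityʳ _) (ℕ.+-identityʳ _))

  row-slope : isZero b * N + isZero q * M ≡ suc a * N
  row-slope =
    trans (cong (_+ isZero q * M) (sym (ℕ.+-identityʳ (isZero b * N))))
          (trans (singletons-balance atOne₁) (ℕ.+-identityʳ _))

unit-multiple : ∀ x n → 1 * suc n + 0 ≡ suc x * suc n → x ≡ 0
unit-multiple x n eq = ℕ.suc-injective (sym (ℕ.*-cancelʳ-≡ 1 (suc x) (suc n) (trans (sym (ℕ.+-identityʳ _)) eq)))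

double-multiple : ∀ x n → 1 * suc n + 1 * suc n ≡ suc (suc x) * suc n → x ≡ 0
double-multiple x n eq =
  ℕ.suc-injective (ℕ.suc-injective (sym (ℕ.*-cancelʳ-≡ 2 (suc (suc x)) (suc n) (trans (twice (suc n)) eq))))
  where
  twice : ∀ y → 2 * y ≡ 1 * y + 1 * y
  twice = ℕ-Solver.solve-∀

no-excess : ∀ n m → 1 * suc n + 1 * suc m ≢ 1 * suc n
no-excess n m = ℕ.m+1+n≢m (1 * suc n)

choose₂-large : ∀ c → 4 + c < choose₂ (4 + c)
choose₂-large c = begin-strict
  4 + c                                 <⟨ ℕ.m≤m+n (5 + c) c ⟩
  5 + c + c                             ≡⟨ regroup c ⟩
  (2 + c) + (3 + c)                     ≤⟨ ℕ.+-monoˡ-≤ (3 + c) (ℕ.m≤n+m (2 + c) (choose₂ (2 + c))) ⟩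
  choose₂ (2 + c) + (2 + c) + (3 + c)   ∎
  where
  open ℕ.≤-Reasoning
  regroup : ∀ c → 5 + c + c ≡ (2 + c) + (3 + c)
  regroup = ℕ-Solver.solve-∀

curvature-too-large : ∀ c n m →
  0 * suc n + (choose₂ (4 + c) * suc n + 0 * suc n + 0 * suc m) ≡ 0 * suc n + (0 * suc n + 0 * suc n + 1 * suc m) →
  1 * suc m ≡ (4 + c) * suc n → ⊥
curvature-too-large c n m curvature slope =
  ℕ.<-irrefl (sym (ℕ.*-cancelʳ-≡ (choose₂ (4 + c)) (4 + c) (suc n) choose₂≡)) (choose₂-large c)
  where
  tidy : ∀ x → x ≡ x + 0 + 0
  tidy = ℕ-Solver.solve-∀
  choose₂≡ : choose₂ (4 + c) * suc n ≡ (4 + c) * suc n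
  choose₂≡ = trans (tidy (choose₂ (4 + c) * suc n)) (trans curvature slope)

-- The masses at (0,1) and (1,0) exactly balance the origin at t = 1/2, leaving
-- the interior mass unbalanced.
halving-too-large : ∀ d e n m → 0 < d →
  0 * suc n + (2 ^ (d ∸ 1) * suc n + 2 ^ (d ∸ 1) * suc n + 2 ^ e * suc m)
    ≡ 2 ^ d * suc n + (0 * suc n + 0 * suc n + 0 * suc m) → ⊥
halving-too-large (suc d) e n m _ halving =
  ℕ.<⇒≢ (ℕ.*-monoˡ-< (suc m) (ℕ.m^n>0 2 e))
        (sym (ℕ.+-cancelˡ-≡ (2 ^ d * suc n + 2 ^ d * suc n) (2 ^ e * suc m) 0
                             (trans halving (halves (2 ^ d) (suc n)))))
  where
  halves : ∀ h N → 2 * h * N + 0 ≡ h * N + h * N + 0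
  halves = ℕ-Solver.solve-∀

pos-multiple : ∀ x m n → 1 * suc m ≡ x * suc n → + suc m ≡ + x *ℤ + suc n
pos-multiple x m n eq = trans (cong +_ (trans (sym (ℕ.*-identityˡ (suc m))) eq)) (ℤ.pos-* x (suc n))

out2-multiple : ∀ n m → 1 * suc m ≡ 3 * suc n → BasicMultiple (config -[1+ n ] (singletons 2 2 0 0 n m))
out2-multiple n m slope =
  basic-multiple (suc n) out2 (there (here refl)) (λ _ _ → refl) (refl , refl , refl , refl , tt) λ i j →
    trans (cong (λ y → -[1+ n ] *ℤ δ 0 0 i j +ℤ (+ suc n *ℤ δ 0 3 i j +ℤ 0ℤ +ℤ (+ suc n *ℤ δ 3 0 i j +ℤ 0ℤ)
                          +ℤ (y *ℤ δ 1 1 i j +ℤ 0ℤ))) (pos-multiple 3 m n slope))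
          (regroup (+ suc n) (δ 0 0 i j) (δ 3 0 i j) (δ 1 1 i j) (δ 0 3 i j))
  where
  regroup : ∀ x o r c t → - x *ℤ o +ℤ (x *ℤ t +ℤ 0ℤ +ℤ (x *ℤ r +ℤ 0ℤ) +ℤ (+ 3 *ℤ x *ℤ c +ℤ 0ℤ))
                          ≡ x *ℤ (-1ℤ *ℤ o +ℤ (1ℤ *ℤ r +ℤ (+ 3 *ℤ c +ℤ (1ℤ *ℤ t +ℤ 0ℤ))))
  regroup = solve-∀

out3-multiple : ∀ n m → 1 * suc m ≡ 2 * suc n → BasicMultiple (config -[1+ n ] (singletons 1 1 0 0 n m))
out3-multiple n m slope =
  basic-multiple (suc n) out3 (there (there (here refl))) (λ _ _ → refl) (refl , refl , refl , refl , tt) λ i j →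
    trans (cong (λ y → -[1+ n ] *ℤ δ 0 0 i j +ℤ (+ suc n *ℤ δ 0 2 i j +ℤ 0ℤ +ℤ (+ suc n *ℤ δ 2 0 i j +ℤ 0ℤ)
                          +ℤ (y *ℤ δ 1 1 i j +ℤ 0ℤ))) (pos-multiple 2 m n slope))
          (regroup (+ suc n) (δ 0 0 i j) (δ 2 0 i j) (δ 1 1 i j) (δ 0 2 i j))
  where
  regroup : ∀ x o r c t → - x *ℤ o +ℤ (x *ℤ t +ℤ 0ℤ +ℤ (x *ℤ r +ℤ 0ℤ) +ℤ (+ 2 *ℤ x *ℤ c +ℤ 0ℤ))
                          ≡ x *ℤ (-1ℤ *ℤ o +ℤ (1ℤ *ℤ r +ℤ (+ 2 *ℤ c +ℤ (1ℤ *ℤ t +ℤ 0ℤ))))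
  regroup = solve-∀

out4-multiple : ∀ n → BasicMultiple (config -[1+ n ] (singletons 0 1 0 0 n n))
out4-multiple n =
  basic-multiple (suc n) out4 (there (there (there (here refl)))) (λ _ _ → refl) (refl , refl , refl , refl , tt)
    λ i j →
    regroup (+ suc n) (δ 0 0 i j) (δ 2 0 i j) (δ 0 1 i j) (δ 1 1 i j)
  where
  regroup : ∀ x o r t c → - x *ℤ o +ℤ (x *ℤ t +ℤ 0ℤ +ℤ (x *ℤ r +ℤ 0ℤ) +ℤ (x *ℤ c +ℤ 0ℤ))
                          ≡ x *ℤ (-1ℤ *ℤ o +ℤ (1ℤ *ℤ r +ℤ (1ℤ *ℤ t +ℤ (1ℤ *ℤ c +ℤ 0ℤ))))
  regroup = solve-∀

out5-multiple : ∀ n → BasicMultiple (config -[1+ n ] (singletons 1 0 0 0 n n))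
out5-multiple n =
  basic-multiple (suc n) out5 (there (there (there (there (here refl))))) (λ _ _ → refl) (refl , refl , refl , refl , tt)
    λ i j →
    regroup (+ suc n) (δ 0 0 i j) (δ 1 0 i j) (δ 1 1 i j) (δ 0 2 i j)
  where
  regroup : ∀ x o r c t → - x *ℤ o +ℤ (x *ℤ t +ℤ 0ℤ +ℤ (x *ℤ r +ℤ 0ℤ) +ℤ (x *ℤ c +ℤ 0ℤ))
                          ≡ x *ℤ (-1ℤ *ℤ o +ℤ (1ℤ *ℤ r +ℤ (1ℤ *ℤ c +ℤ (1ℤ *ℤ t +ℤ 0ℤ))))
  regroup = solve-∀

same-mass : ∀ m n → 1 * suc m ≡ 1 * suc n → m ≡ n
same-mass m n eq = ℕ.suc-injective (ℕ.*-cancelˡ-≡ (suc m) (suc n) 1 eq)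

equal-multiples : ∀ a b n m → 1 * suc m ≡ suc (suc b) * suc n → 1 * suc m ≡ suc (suc a) * suc n → a ≡ b
equal-multiples a b n m slope₀ slope₁ =
  ℕ.suc-injective (ℕ.suc-injective (ℕ.*-cancelʳ-≡ (suc (suc a)) (suc (suc b)) (suc n) (trans (sym slope₁) slope₀)))

singletons-multiple : ∀ {d} b a p q n m → 0 < d → (∀ (F : Weight d) → Balanced F 0 (suc n) (singletons b a p q n m)) →
                      BasicMultiple (config -[1+ n ] (singletons b a p q n m))
singletons-multiple b (suc a) (suc p) q n m _ balanced with column-slope b (suc a) (suc p) q n m balanced
... | ()
singletons-multiple b zero (suc p) zero n m _ balanced
  with unit-multiple b n (column-slope b 0 (suc p) 0 n m balanced)
... | refl = ⊥-elim (no-excess n m (row-slope 0 0 (suc p) 0 n m balanced))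
singletons-multiple {d} b zero (suc p) (suc q) n m d>0 balanced
  with unit-multiple b n (column-slope b 0 (suc p) (suc q) n m balanced)
... | refl = ⊥-elim (halving-too-large d (d ∸ (suc (suc p) + suc (suc q))) n m d>0
                       (singletons-balance 0 0 (suc p) (suc q) n m balanced (atHalf d)))
singletons-multiple (suc b) a zero (suc q) n m _ balanced with row-slope (suc b) a 0 (suc q) n m balanced
... | ()
singletons-multiple zero a zero (suc q) n m _ balanced
  with unit-multiple a n (row-slope 0 a 0 (suc q) n m balanced)
... | refl = ⊥-elim (no-excess n m (column-slope 0 0 0 (suc q) n m balanced))
singletons-multiple zero zero zero zero n m _ balanced =
  ⊥-elim (no-excess n m (column-slope 0 0 0 0 n m balanced))
singletons-multiple (suc b) zero zero zero n m _ balanced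
  with same-mass m n (row-slope (suc b) 0 0 0 n m balanced)
... | refl with double-multiple b n (column-slope (suc b) 0 0 0 n n balanced)
...   | refl = out5-multiple n
singletons-multiple zero (suc a) zero zero n m _ balanced
  with same-mass m n (column-slope 0 (suc a) 0 0 n m balanced)
... | refl with double-multiple a n (row-slope 0 (suc a) 0 0 n n balanced)
...   | refl = out4-multiple n
singletons-multiple (suc b) (suc a) zero zero n m _ balanced
  with equal-multiples a b n m (column-slope (suc b) (suc a) 0 0 n m balanced)
                                (row-slope (suc b) (suc a) 0 0 n m balanced)
singletons-multiple (suc zero) (suc .zero) zero zero n m _ balanced | refl =
  out3-multiple n m (column-slope 1 1 0 0 n m balanced)
singletons-multiple (suc (suc zero)) (suc .(suc zero)) zero zero n m _ balanced | refl =
  out2-multiple n m (column-slope 2 2 0 0 n m balanced)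
singletons-multiple (suc (suc (suc c))) (suc .(suc (suc c))) zero zero n m _ balanced | refl =
  ⊥-elim (curvature-too-large c n m (singletons-balance (3 + c) (3 + c) 0 0 n m balanced atZero₂)
                                    (column-slope (3 + c) (3 + c) 0 0 n m balanced))

length≡0⇒≡[] : ∀ {A : Set} (xs : List A) → length xs ≡ 0 → xs ≡ []
length≡0⇒≡[] [] _ = refl

one-each : ∀ {A B C : Set} (xs : List A) (ys : List B) (zs : List C) →
  suc (length xs) + suc (length ys) + suc (length zs) ≤ 3 → xs ≡ [] × ys ≡ [] × zs ≡ []
one-each xs ys zs size≤3 =
  length≡0⇒≡[] xs (ℕ.m+n≡0⇒m≡0 (length xs) (ℕ.m+n≡0⇒m≡0 (length xs + length ys) rest≡0)) ,
  length≡0⇒≡[] ys (ℕ.m+n≡0⇒n≡0 (length xs) (ℕ.m+n≡0⇒m≡0 (length xs + length ys) rest≡0)) ,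
  length≡0⇒≡[] zs (ℕ.m+n≡0⇒n≡0 (length xs + length ys) rest≡0)
  where
  regroup : ∀ u v w → suc u + suc v + suc w ≡ 3 + (u + v + w)
  regroup = ℕ-Solver.solve-∀
  rest≡0 : length xs + length ys + length zs ≡ 0
  rest≡0 = ℕ.n≤0⇒n≡0 (ℕ.+-cancelˡ-≤ 3 _ 0 (subst (_≤ 3) (regroup (length xs) (length ys) (length zs)) size≤3))

singleton-mass : ∀ {X : Set} (x : X) k n → mass ((x , k) ∷ []) ≡ suc n → k ≡ n
singleton-mass _ k n eq = trans (sym (ℕ.+-identityʳ k)) (ℕ.suc-injective eq)

negative-origin : ∀ {d} n s → size s ≤ 3 → Within d s → (∀ (F : Weight d) → Balanced F 0 (suc n) s) →
                  BasicMultiple (config -[1+ n ] s)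
negative-origin {d} n s@(support col row []) _ _ balanced =
  let col-unit , row-unit = unit-sites {d} {n} col row (balanced atZero₀) (balanced atOne₀) (balanced atZero₁)
  in out1-multiple n col row (column-mass {d} n s (balanced atZero₀)) (row-mass {d} n s (balanced atOne₀))
                    col-unit row-unit
negative-origin {d} n s@(support [] _ (_ ∷ _)) _ _ balanced with column-mass {d} n s (balanced atZero₀)
... | ()
negative-origin {d} n s@(support (_ ∷ _) [] (_ ∷ _)) _ _ balanced with row-mass {d} n s (balanced atOne₀)
... | ()
negative-origin {d} n s@(support ((b , k) ∷ xs) ((a , l) ∷ ys) (((p , q) , m) ∷ zs)) size≤3 (b<d ∷ _ , _) balanced
  with one-each xs ys zs size≤3
... | refl , refl , refl
  with singleton-mass b k n (column-mass {d} n s (balanced atZero₀))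
     | singleton-mass a l n (row-mass {d} n s (balanced atOne₀))
...   | refl | refl = singletons-multiple b a p q n m (ℕ.≤-trans (s≤s z≤n) b<d) balanced

balanced⇒basic-multiple : ∀ {d} c s → size s ≤ 3 → Within d s →
  (∀ n₁ n₂ → c ≡ + n₁ -ℤ + n₂ → ∀ (F : Weight d) → Balanced F n₁ n₂ s) → BasicMultiple (config c s)
balanced⇒basic-multiple {d} (+ n) s _ _ balanced
  with nonnegative-origin d n s (balanced n 0 (sym (ℤ.+-identityʳ (+ n))) (atHalf d))
... | refl , refl = 0 , out1 , here refl , λ i j → refl
balanced⇒basic-multiple -[1+ n ] s size≤3 s∈d balanced = negative-origin n s size≤3 s∈d (balanced 0 (suc n) refl)

theorem5p14 : (d : ℕ) (w : Config) →
    Outcome d w → Valid d w → PosSupportAtMost3 d w →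
    Σ ℕ λ k → Σ Config λ u → (u ∈ Basic) × (w ≈[ d ] scale k u)
theorem5p14 d w outcome valid (L , |L|≤3 , positives) =
  let s , size≤|L| , s∈d , w≈s = decompose L valid (λ i j ij≤d _ → positives i j ij≤d)
      k , u , u∈Basic , s≗ku = balanced⇒basic-multiple (w 0 0) s (ℕ.≤-trans size≤|L| |L|≤3) s∈d
                                 (λ n₁ n₂ w₀₀≡ F → balanced F outcome w≈s s∈d w₀₀≡)
  in k , u , u∈Basic , λ i j ij≤d → trans (w≈s i j ij≤d) (s≗ku i j)
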